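{- Let $\phi$ be a stable state, $v\in\Gamma$, and $F:\Gamma\to\mathbb{Z}_{\ge0}$ a function such that $F(v)\ge1$ and $\phi+\Delta F$ is stable. Then $F\ge H^v_\phi$ pointwise.
   Context: Let $\Gamma$ be an at most countable set with a threshold function $\tau:\Gamma\to\mathbb{Z}_{>0}$ and a neighbour map $\gamma:\Gamma\to2^\Gamma$ satisfying: - $v\notin\gamma(v)$; - $v\in\gamma(w)$ iff $w\in\gamma(v)$; - $|\gamma(v)|\le\tau(v)$. Write $u\sim v$ for $u\in\gamma(v)$. The Laplacian is $\Delta\phi(v)=-\tau(v)\phi(v)+\sum_{u\sim v}\phi(u)$. States are functions $\phi:\Gamma\to\mathbb{Z}$, and $T_v\phi=\phi+\Delta\delta_v$. A relaxation of $\phi$ is a finite or infinite sequence $\phi_0=\phi$, $\phi_{k+1}=T_{v_k}\phi_k$ with $\phi_k(v_k)\ge\tau(v_k)$. Its toppling function is $H_{\phi_\bullet}=\sum_i\delta_{v_i}$. It is locally finite if this is finite everywhere. A state is stable if $\phi<\tau$ everywhere. It is relaxable if some locally finite relaxation has the stable result $\phi+\Delta H_{\phi_\bullet}$; $H_\phi$ denotes the (unique) toppling function of such a stabilizing relaxation. For a stable $\phi$, the state $T_v\phi$ is relaxable, and the wave-toppling function is $H^v_\phi=\delta_v+H_{T_v\phi}$. -}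

module Defs where

open import Data.Nat as ℕ using (ℕ; zero; suc)
open import Data.Integer as ℤ using (ℤ; +_; _+_; _*_; -_; _<_; _≤_; _≥_)
open import Data.List using (List; length; map; foldr)
open import Data.List.Membership.Propositional using (_∈_; _∉_)
open import Data.List.Relation.Unary.Unique.Propositional using (Unique)
open import Data.Product using (Σ; ∃; _×_; _,_)
open import Data.Unit using (⊤)
open import Relation.Nullary using (¬_; Dec; yes; no)
open import Relation.Binary.Definitions using (DecidableEquality)
open import Relation.Binary.PropositionalEquality using (_≡_; _≢_)
open import Function.Definitions using (Injective)

-- The underlying "graph": an at most countable vertex set Γ with
-- threshold τ and neighbour map γ.  Since |γ(v)| ≤ τ(v) < ∞, γ(v) is
-- represented as a duplicate-free list.
record Graph : Set₁ where
  field
    Γ        : Set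
    _≟_      : DecidableEquality Γ
    enc      : Γ → ℕ
    enc-inj  : Injective _≡_ _≡_ enc          -- at most countable
    τ        : Γ → ℕ
    τ-pos    : ∀ v → 1 ℕ.≤ τ v
    γ        : Γ → List Γ
    γ-unique : ∀ v → Unique (γ v)
    γ-irrefl : ∀ v → v ∉ γ v
    γ-sym    : ∀ v w → v ∈ γ w → w ∈ γ v
    γ-bound  : ∀ v → length (γ v) ℕ.≤ τ v

module _ (G : Graph) where
  open Graph G

  State : Set
  State = Γ → ℤ

  Δ : (Γ → ℤ) → Γ → ℤ
  Δ φ v = - (+ τ v) * φ v + foldr _+_ (+ 0) (map φ (γ v))

  δ : Γ → Γ → ℤ
  δ v w with w ≟ v
  ... | yes _ = + 1
  ... | no  _ = + 0

  _⊕_ : (Γ → ℤ) → (Γ → ℤ) → Γ → ℤ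
  (f ⊕ g) w = f w + g w

  T : Γ → State → State
  T v φ = φ ⊕ Δ (δ v)

  Stable : State → Set
  Stable φ = ∀ v → φ v < + τ v

  data Length : Set where
    fin : ℕ → Length
    inf : Length

  _<ᴸ_ : ℕ → Length → Set
  k <ᴸ fin n = k ℕ.< n
  k <ᴸ inf   = ⊤

  _<ᴸ?_ : ∀ k L → Dec (k <ᴸ L)
  k <ᴸ? fin n = k ℕ.<? n
  k <ᴸ? inf   = yes _

  stateAt : State → (ℕ → Γ) → ℕ → State
  stateAt φ s zero    = φ
  stateAt φ s (suc k) = T (s k) (stateAt φ s k)

  -- A relaxation of φ: a (finite or infinite) sequence of legal topplings.
  -- Entries of `site` at indices ≥ the length are irrelevant.
  record Relaxation (φ : State) : Set where
    field
      len   : Length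
      site  : ℕ → Γ
      legal : ∀ k → k <ᴸ len → + τ (site k) ≤ stateAt φ site k (site k)

  occ : Length → (ℕ → Γ) → Γ → ℕ → ℕ
  occ L s w zero = zero
  occ L s w (suc N) with N <ᴸ? L | s N ≟ w
  ... | yes _ | yes _ = suc (occ L s w N)
  ... | _     | _     = occ L s w N

  -- H is the toppling function Σ_i δ_{v_i} of the relaxation R and R is
  -- locally finite: every w occurs only finitely often, exactly H w times.
  IsTopplingFunction : ∀ {φ} → Relaxation φ → (Γ → ℕ) → Set
  IsTopplingFunction R H =
    ∀ w → ∃ λ N → (∀ k → N ℕ.≤ k → k <ᴸ Relaxation.len R → Relaxation.site R k ≢ w)
                × occ (Relaxation.len R) (Relaxation.site R) w N ≡ H w

  toℤ : (Γ → ℕ) → Γ → ℤ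
  toℤ H w = + H w

  -- H is the toppling function of a locally finite relaxation of φ whose
  -- result φ + ΔH is stable; this is H_φ (unique by the paper).
  IsStabilizingToppling : State → (Γ → ℕ) → Set
  IsStabilizingToppling φ H =
    Σ (Relaxation φ) λ R → IsTopplingFunction R H × Stable (φ ⊕ Δ (toℤ H))

module Submission where

-- Let R be the stabilizing relaxation of T_v φ and let g_N = δ_v + (number
-- of topplings among the first N steps of R), so that by the odometer
-- formula the N-th state of R is φ + Δ g_N.  We show g_N ≤ F for every N by
-- induction.  Initially g_0 = δ_v ≤ F because F(v) ≥ 1.  If g_N ≤ F and the
-- site u = v_N topples, then g_N(u) < F(u): otherwise g_N and F agree at u
-- and g_N ≤ F elsewhere, so (φ + Δ g_N)(u) ≤ (φ + Δ F)(u) < τ(u), which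
-- contradicts legality of the toppling.  Hence g_{N+1} = g_N + δ_u ≤ F.
-- Local finiteness gives an N with g_N(w) = (δ_v + H)(w), which is the claim.

open import Defs
open import Data.Nat using (ℕ; _≤_; _+_)
open import Data.Integer using (ℤ; +_)

import Data.Nat as Nat
open Nat using (suc; zero)
import Data.Nat.Properties as NatP
import Data.Integer as Int
open Int using () renaming (_+_ to _+ᶻ_; _≤_ to _≤ᶻ_; _<_ to _<ᶻ_; _*_ to _*ᶻ_; -_ to -ᶻ_)
import Data.Integer.Properties as ℤP
open import Algebra.Properties.CommutativeSemigroup ℤP.+-commutativeSemigroup
  using (interchange)
open import Data.List using (List; []; _∷_; map; foldr)
open import Data.List.Properties using (map-cong)
open import Data.Product using (_,_)
open import Data.Empty using (⊥-elim)
open import Data.Unit using (tt)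
open import Relation.Nullary using (yes; no; ¬_; Dec)
open import Relation.Binary.PropositionalEquality

module Development (G : Graph) where
  open Graph G

  _≤ᶠ_ : (Γ → ℤ) → (Γ → ℤ) → Set
  f ≤ᶠ g = ∀ x → f x ≤ᶻ g x

  sumOver : (Γ → ℤ) → List Γ → ℤ
  sumOver f xs = foldr _+ᶻ_ (+ 0) (map f xs)

  sumOver-cong : ∀ {f g} → (∀ x → f x ≡ g x) → ∀ xs → sumOver f xs ≡ sumOver g xs
  sumOver-cong f≗g xs = cong (foldr _+ᶻ_ (+ 0)) (map-cong f≗g xs)

  sumOver-+ : ∀ f g xs → sumOver (_⊕_ G f g) xs ≡ sumOver f xs +ᶻ sumOver g xs
  sumOver-+ f g []       = refl
  sumOver-+ f g (x ∷ xs) = begin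
    (f x +ᶻ g x) +ᶻ sumOver (_⊕_ G f g) xs
      ≡⟨ cong ((f x +ᶻ g x) +ᶻ_) (sumOver-+ f g xs) ⟩
    (f x +ᶻ g x) +ᶻ (sumOver f xs +ᶻ sumOver g xs)
      ≡⟨ interchange (f x) (g x) (sumOver f xs) (sumOver g xs) ⟩
    (f x +ᶻ sumOver f xs) +ᶻ (g x +ᶻ sumOver g xs) ∎
    where open ≡-Reasoning

  sumOver-mono : ∀ {f g} → f ≤ᶠ g → ∀ xs → sumOver f xs ≤ᶻ sumOver g xs
  sumOver-mono f≤g []       = ℤP.≤-refl
  sumOver-mono f≤g (x ∷ xs) = ℤP.+-mono-≤ (f≤g x) (sumOver-mono f≤g xs)

  sumOver-zero : ∀ xs → sumOver (λ _ → + 0) xs ≡ + 0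
  sumOver-zero []       = refl
  sumOver-zero (_ ∷ xs) = trans (ℤP.+-identityˡ _) (sumOver-zero xs)

  Δ-cong : ∀ {f g} → (∀ x → f x ≡ g x) → ∀ u → Δ G f u ≡ Δ G g u
  Δ-cong {f} {g} f≗g u =
    cong₂ _+ᶻ_ (cong (-ᶻ (+ τ u) *ᶻ_) (f≗g u)) (sumOver-cong f≗g (γ u))

  Δ-+ : ∀ f g u → Δ G (_⊕_ G f g) u ≡ Δ G f u +ᶻ Δ G g u
  Δ-+ f g u = begin
    c *ᶻ (f u +ᶻ g u) +ᶻ sumOver (_⊕_ G f g) (γ u)
      ≡⟨ cong₂ _+ᶻ_ (ℤP.*-distribˡ-+ c (f u) (g u)) (sumOver-+ f g (γ u)) ⟩
    (c *ᶻ f u +ᶻ c *ᶻ g u) +ᶻ (sumOver f (γ u) +ᶻ sumOver g (γ u))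
      ≡⟨ interchange (c *ᶻ f u) (c *ᶻ g u) (sumOver f (γ u)) (sumOver g (γ u)) ⟩
    Δ G f u +ᶻ Δ G g u ∎
    where
    open ≡-Reasoning
    c = -ᶻ (+ τ u)

  Δ-zero : ∀ u → Δ G (λ _ → + 0) u ≡ + 0
  Δ-zero u = cong₂ _+ᶻ_ (ℤP.*-zeroʳ (-ᶻ (+ τ u))) (sumOver-zero (γ u))

  -- Off-diagonal monotonicity of Δ: if f ≤ g everywhere and f(u) = g(u),
  -- then Δf(u) ≤ Δg(u), since only the neighbour sum can differ.
  Δ-mono-at : ∀ {f g} → f ≤ᶠ g → ∀ u → f u ≡ g u → Δ G f u ≤ᶻ Δ G g u
  Δ-mono-at {f} {g} f≤g u fu≡gu rewrite fu≡gu =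
    ℤP.+-monoʳ-≤ (-ᶻ (+ τ u) *ᶻ g u) (sumOver-mono f≤g (γ u))

  ⊕δ-≤ : ∀ {f F u} → f ≤ᶠ F → f u <ᶻ F u → _⊕_ G f (δ G u) ≤ᶠ F
  ⊕δ-≤ {f} {F} {u} f≤F fu<Fu x with x ≟ u
  ... | yes refl = subst (_≤ᶻ F x) (ℤP.+-comm (+ 1) (f x)) (ℤP.i<j⇒suc[i]≤j fu<Fu)
  ... | no _     = subst (_≤ᶻ F x) (sym (ℤP.+-identityʳ (f x))) (f≤F x)

  unstable-site-below : ∀ φ {g F u} → Stable G (_⊕_ G φ (Δ G F)) → g ≤ᶠ F →
                        + τ u ≤ᶻ φ u +ᶻ Δ G g u → g u <ᶻ F u
  unstable-site-below φ {g} {F} {u} stableF g≤F unstable =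
    ℤP.≤∧≢⇒< (g≤F u) λ gu≡Fu →
      ℤP.<⇒≱ (stableF u)
        (ℤP.≤-trans unstable (ℤP.+-monoʳ-≤ (φ u) (Δ-mono-at g≤F u gu≡Fu)))

  <ᴸ-downward : ∀ L {k N} → k Nat.< N → _<ᴸ_ G N L → _<ᴸ_ G k L
  <ᴸ-downward (fin n) k<N N<n = NatP.<-trans k<N N<n
  <ᴸ-downward inf     _   _   = tt

  count : Length G → (ℕ → Γ) → ℕ → Γ → ℤ
  count L s N = toℤ G (λ x → occ G L s x N)

  count-step : ∀ L s N → _<ᴸ_ G N L → ∀ x → count L s (suc N) x ≡ count L s N x +ᶻ δ G (s N) x
  count-step L s N N<L x with _<ᴸ?_ G N L | s N ≟ x | x ≟ s N
  ... | no N≮L | _        | _        = ⊥-elim (N≮L N<L)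
  ... | yes _  | yes _    | yes _    = cong +_ (NatP.+-comm 1 (occ G L s x N))
  ... | yes _  | yes sN≡x | no x≢sN  = ⊥-elim (x≢sN (sym sN≡x))
  ... | yes _  | no sN≢x  | yes x≡sN = ⊥-elim (sN≢x (sym x≡sN))
  ... | yes _  | no _     | no _     = sym (ℤP.+-identityʳ _)

  count-stop : ∀ L s N → ¬ _<ᴸ_ G N L → ∀ x → count L s (suc N) x ≡ count L s N x
  count-stop L s N N≮L x with _<ᴸ?_ G N L
  ... | yes N<L = ⊥-elim (N≮L N<L)
  ... | no _    = refl

  odometer : ∀ ψ L s N → (∀ k → k Nat.< N → _<ᴸ_ G k L) → ∀ u →
             stateAt G ψ s N u ≡ ψ u +ᶻ Δ G (count L s N) u
  odometer ψ L s zero    _         u = sym (begin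
    ψ u +ᶻ Δ G (λ _ → + 0) u ≡⟨ cong (ψ u +ᶻ_) (Δ-zero u) ⟩
    ψ u +ᶻ + 0               ≡⟨ ℤP.+-identityʳ (ψ u) ⟩
    ψ u                      ∎)
    where open ≡-Reasoning
  odometer ψ L s (suc N) prefix u = begin
    stateAt G ψ s N u +ᶻ Δ G (δ G (s N)) u
      ≡⟨ cong (_+ᶻ Δ G (δ G (s N)) u) (odometer ψ L s N (λ k k<N → prefix k (NatP.m<n⇒m<1+n k<N)) u) ⟩
    (ψ u +ᶻ Δ G (count L s N) u) +ᶻ Δ G (δ G (s N)) u
      ≡⟨ ℤP.+-assoc (ψ u) _ _ ⟩
    ψ u +ᶻ (Δ G (count L s N) u +ᶻ Δ G (δ G (s N)) u)
      ≡⟨ cong (ψ u +ᶻ_) (sym (Δ-+ (count L s N) (δ G (s N)) u)) ⟩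
    ψ u +ᶻ Δ G (_⊕_ G (count L s N) (δ G (s N))) u
      ≡⟨ cong (ψ u +ᶻ_) (Δ-cong (λ x → sym (count-step L s N (prefix N NatP.≤-refl) x)) u) ⟩
    ψ u +ᶻ Δ G (count L s (suc N)) u ∎
    where open ≡-Reasoning

  δ-below : ∀ {u} (F : Γ → ℕ) → 1 ≤ F u → δ G u ≤ᶠ toℤ G F
  δ-below {u} F 1≤Fu x with x ≟ u
  ... | yes refl = Int.+≤+ 1≤Fu
  ... | no _     = Int.+≤+ Nat.z≤n

  module Wave (φ : State G) (v : Γ) (F : Γ → ℕ) (1≤Fv : 1 ≤ F v)
              (stableF : Stable G (_⊕_ G φ (Δ G (toℤ G F))))
              (R : Relaxation G (T G v φ)) where
    open Relaxation R renaming (len to L; site to s)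

    wave : ℕ → Γ → ℤ
    wave N = _⊕_ G (δ G v) (count L s N)

    wave-state : ∀ N → _<ᴸ_ G N L → ∀ u → stateAt G (T G v φ) s N u ≡ φ u +ᶻ Δ G (wave N) u
    wave-state N N<L u = begin
      stateAt G (T G v φ) s N u
        ≡⟨ odometer (T G v φ) L s N (λ k k<N → <ᴸ-downward L k<N N<L) u ⟩
      (φ u +ᶻ Δ G (δ G v) u) +ᶻ Δ G (count L s N) u
        ≡⟨ ℤP.+-assoc (φ u) _ _ ⟩
      φ u +ᶻ (Δ G (δ G v) u +ᶻ Δ G (count L s N) u)
        ≡⟨ cong (φ u +ᶻ_) (sym (Δ-+ (δ G v) (count L s N) u)) ⟩
      φ u +ᶻ Δ G (wave N) u ∎
      where open ≡-Reasoning

    wave-step : ∀ N → _<ᴸ_ G N L → ∀ x → wave (suc N) x ≡ _⊕_ G (wave N) (δ G (s N)) x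
    wave-step N N<L x = trans (cong (δ G v x +ᶻ_) (count-step L s N N<L x))
                              (sym (ℤP.+-assoc (δ G v x) _ _))

    wave-below : ∀ N → wave N ≤ᶠ toℤ G F
    wave-below zero x =
      subst (_≤ᶻ + F x) (sym (ℤP.+-identityʳ (δ G v x))) (δ-below F 1≤Fv x)
    wave-below (suc N) = step (_<ᴸ?_ G N L)
      where
      step : Dec (_<ᴸ_ G N L) → wave (suc N) ≤ᶠ toℤ G F
      step (no N≮L) x = subst (_≤ᶻ + F x) (cong (δ G v x +ᶻ_) (sym (count-stop L s N N≮L x)))
                              (wave-below N x)
      step (yes N<L)  = λ x → subst (_≤ᶻ + F x) (sym (wave-step N N<L x))
                                    (⊕δ-≤ (wave-below N) site-below x)
        where
        -- the toppling site v_N is unstable in φ + Δ g_N, hence strictly below F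
        site-below : wave N (s N) <ᶻ + F (s N)
        site-below = unstable-site-below φ stableF (wave-below N)
          (subst (+ τ (s N) ≤ᶻ_) (wave-state N N<L (s N)) (legal N N<L))

-- Proposition A.26.  Local finiteness of the stabilizing relaxation gives an
-- N with (δ_v + H)(w) = g_N(w) ≤ F(w).
propositionA26 : (G : Graph) → let open Graph G in
    (φ : Γ → ℤ) → Stable G φ → (v : Γ) → (F : Γ → ℕ) → 1 ≤ F v →
    Stable G (_⊕_ G φ (Δ G (toℤ G F))) →
    (H : Γ → ℕ) → IsStabilizingToppling G (T G v φ) H →
    ∀ w → _⊕_ G (δ G v) (toℤ G H) w Data.Integer.≤ + F w
propositionA26 G φ _ v F 1≤Fv stableF H (R , toppling , _) w with toppling w
... | N , _ , occ≡H =
  subst (λ t → δ G v w +ᶻ + t ≤ᶻ + F w) occ≡H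
        (Wave.wave-below φ v F 1≤Fv stableF R N w)
  where open Development G
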